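{- Let $\mathcal B,\mathcal B_1,\mathcal B_2\subseteq\mathcal P([n])$ be simply rooted families with $\mathcal B_1\cup\mathcal B_2=\mathcal B$, and let $b$ be the number of bad sets of $\mathcal B$. Then \[ 2^{ -n}|\mathcal B_1||\mathcal B_2|\le b+|\mathcal B_1\cap\mathcal B_2|. \]
   Context: A family $\mathcal F$ is simply rooted if for every nonempty $F\in\mathcal F$ there is $b\in F$ with $\{C:\{b\}\subseteq C\subseteq F\}\subseteq\mathcal F$. For $\mathcal F\subseteq\mathcal P([n])$ and $i\in[n]$: $d_{(i,\mathcal F)}(F)=F\setminus\{i\}$ if $i\in F$ and $F\setminus\{i\}\notin\mathcal F$, else $F$; $d_i(\mathcal F)=\{d_{(i,\mathcal F)}(F):F\in\mathcal F\}$. With $\mathcal F_0=\mathcal F$, $\mathcal F_k=d_k(\mathcal F_{k-1})$, define $d_{\mathcal F}(F)=d_{(n,\mathcal F_{n-1})}\circ\cdots\circ d_{(1,\mathcal F_0)}(F)$ for $F\in\mathcal F$. For a finite set $B$, $\delta B=\{B\setminus\{i\}:i\in B\}$. A set $B\in\mathcal B$ is a bad set of $\mathcal B$ if $\delta B\subseteq\mathcal B$ or $d_{\mathcal B}(B)=B$. -}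

module Defs where

open import Data.Nat using (ℕ; zero; suc)
open import Data.Bool using (Bool; true; false; _∧_; _∨_; not; if_then_else_)
open import Data.Bool.Properties using () renaming (_≟_ to _≟B_)
open import Data.Fin using (Fin)
open import Data.Fin.Subset using (Subset; _∈_; _⊆_; Nonempty; _-_; outside; inside)
open import Data.Vec using (Vec; []; _∷_; lookup)
open import Data.Vec.Properties using (≡-dec)
open import Data.List using (List; []; _∷_; map; _++_; foldl; filter; length; allFin)
open import Data.Bool.ListAction using (any; all)
open import Data.Product using (Σ; _×_; _,_; proj₁; proj₂)
open import Relation.Nullary.Decidable using (⌊_⌋)
open import Relation.Binary.PropositionalEquality using (_≡_)

-- A family of subsets of [n] = Fin n, given by its (Boolean) characteristic function.
-- The element i ∈ [n] of the paper corresponds to Fin index i-1.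
Family : ℕ → Set
Family n = Subset n → Bool

allSubsets : (n : ℕ) → List (Subset n)
allSubsets zero = [] ∷ []
allSubsets (suc n) = map (outside ∷_) (allSubsets n) ++ map (inside ∷_) (allSubsets n)

card : {n : ℕ} → Family n → ℕ
card {n} 𝓕 = length (filter (λ F → 𝓕 F ≟B true) (allSubsets n))

_∩F_ : {n : ℕ} → Family n → Family n → Family n
(𝓕₁ ∩F 𝓕₂) F = 𝓕₁ F ∧ 𝓕₂ F

_≟S_ : {n : ℕ} → (A B : Subset n) → Bool
A ≟S B = ⌊ ≡-dec _≟B_ A B ⌋

SimplyRooted : {n : ℕ} → Family n → Set
SimplyRooted {n} 𝓕 =
  (F : Subset n) → 𝓕 F ≡ true → Nonempty F →
  Σ (Fin n) λ b → b ∈ F × ((C : Subset n) → b ∈ C → C ⊆ F → 𝓕 C ≡ true)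

dSet : {n : ℕ} → Fin n → Family n → Subset n → Subset n
dSet i 𝓕 F = if lookup F i ∧ not (𝓕 (F - i)) then F - i else F

dFam : {n : ℕ} → Fin n → Family n → Family n
dFam {n} i 𝓕 G = any (λ F → 𝓕 F ∧ (dSet i 𝓕 F ≟S G)) (allSubsets n)

step : {n : ℕ} → Family n × Subset n → Fin n → Family n × Subset n
step (𝓖 , G) i = dFam i 𝓖 , dSet i 𝓖 G

-- d_𝓕(F) = d_(n,𝓕_{n-1}) ∘ ⋯ ∘ d_(1,𝓕_0)(F), indices applied in increasing order
dTot : {n : ℕ} → Family n → Subset n → Subset n
dTot {n} 𝓕 F = proj₂ (foldl step (𝓕 , F) (allFin n))

δ⊆ : {n : ℕ} → Subset n → Family n → Bool
δ⊆ {n} B 𝓑 = all (λ i → not (lookup B i) ∨ 𝓑 (B - i)) (allFin n)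

isBad : {n : ℕ} → Family n → Subset n → Bool
isBad 𝓑 B = 𝓑 B ∧ (δ⊆ B 𝓑 ∨ (dTot 𝓑 B ≟S B))

numBad : {n : ℕ} → Family n → ℕ
numBad 𝓑 = card (isBad 𝓑)

module Submission where

-- A single step d_i is injective on 𝓐, keeps |𝓐| (counting in pairs {T, T ∪ {i}}) and simple rootedness,
-- and leaves 𝓐 closed under removing i. Hence 𝓓_j = d_𝓑ⱼ(𝓑_j) are down-sets with |𝓓_j| = |𝓑_j|,
-- and Kleitman's inequality gives |𝓑₁| |𝓑₂| ≤ 2ⁿ |𝓓₁ ∩ 𝓓₂|. The key lemma (dSets-agree): if 𝓑' ⊆ 𝓑
-- are rooted and F ∈ 𝓑' is not bad in 𝓑, then d_𝓑' and d_𝓑 both send F to F - r, r a root of F in 𝓑'.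
-- So every G ∈ 𝓓₁ ∩ 𝓓₂ is d_𝓑₂(F₂) for a bad F₂ ∈ 𝓑₂, or d_𝓑₁(F₁) for some F₁ ∈ 𝓑₁ that is bad or
-- lies in 𝓑₂ (if neither preimage is bad, injectivity of d_𝓑 forces F₁ = F₂). Images are no larger
-- than their sources, which bounds |𝓓₁ ∩ 𝓓₂| by b + |𝓑₁ ∩ 𝓑₂|.

open import Defs
open import Data.Nat using (ℕ; _≤_; _*_; _+_; _^_; zero; suc; z≤n; s≤s; _≤?_)
open import Data.Bool using (_∨_; Bool; true; false; _∧_; not)
open import Data.Fin.Subset using (Subset; _-_)
open import Relation.Binary.PropositionalEquality
  using (_≡_; _≢_; refl; sym; trans; cong; cong₂; subst; subst₂; module ≡-Reasoning)
open import Data.Bool.Properties using (not-involutive; ∨-zeroʳ; ∨-identityʳ; ∧-zeroʳ) renaming (_≟_ to _≟B_)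
open import Data.Nat.Properties
  using (≤-refl; ≤-trans; ≤-reflexive; ≤-antisym; +-comm; +-mono-≤; +-mono-<; <⇒≱; ≰⇒>; m≤m+n; m≤n⇒∃[o]m+o≡n;
         *-monoʳ-≤; *-distribˡ-+; *-assoc; +-commutativeSemigroup; module ≤-Reasoning)
open import Algebra.Properties.CommutativeSemigroup +-commutativeSemigroup using (interchange)
open import Data.Nat.Tactic.RingSolver using (solve-∀)
open import Data.Fin using (Fin; zero; suc)
open import Data.Fin.Properties using (suc-injective) renaming (_≟_ to _≟F_)
open import Data.Fin.Subset.Properties using (p─⊥≡p)
open import Data.Vec using ([]; _∷_; lookup; _[_]≔_; _[_]%=_)
open import Data.Vec.Properties
  using (≡-dec; []=⇒lookup; lookup⇒[]=; lookup∘update; lookup∘update′; lookup∘updateAt; []≔-idempotent;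
         []≔-commutes; []≔-lookup; updateAt-updateAt-local; updateAt-id-local;
         updateAt-cong-local)
open import Data.Vec.Relation.Binary.Pointwise.Extensional using (ext; Pointwise-≡⇒≡)
open import Data.Empty using (⊥; ⊥-elim)
open import Data.Product using (Σ; _×_; _,_; proj₁; proj₂)
open import Data.Sum using (_⊎_; inj₁; inj₂; [_,_])
open import Data.List using (List; []; _∷_; map; _++_; allFin; filter; length; foldl; tabulate)
open import Data.List.Relation.Unary.All using (All; []; _∷_)
open import Data.List.Properties using (filter-++; length-++; map-++; map-tabulate)
open import Data.Bool.ListAction using (any; all)
open import Data.List.Membership.Propositional using (_∈_)
open import Data.List.Membership.Propositional.Properties using (∈-map⁺; ∈-++⁺ˡ; ∈-++⁺ʳ; ∈-allFin)
open import Data.List.Relation.Unary.Any using (here; there)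
open import Relation.Nullary using (yes; no)

infix 4 _∋_ _∌_ _⊑_

_∋_ : ∀ {n} → Subset n → Fin n → Set
T ∋ i = lookup T i ≡ true

_∌_ : ∀ {n} → Subset n → Fin n → Set
T ∌ i = lookup T i ≡ false

_⊑_ : ∀ {n} → Subset n → Subset n → Set
C ⊑ T = ∀ x → C ∋ x → T ∋ x

true≢false : true ≢ false
true≢false ()

subset-ext : ∀ {n} {S T : Subset n} → (∀ x → lookup S x ≡ lookup T x) → S ≡ T
subset-ext h = Pointwise-≡⇒≡ (ext h)

del-is-update : ∀ {n} (T : Subset n) i → T - i ≡ T [ i ]≔ false
del-is-update (x ∷ T) zero = cong (false ∷_) (p─⊥≡p T)
del-is-update (x ∷ T) (suc i) = cong (x ∷_) (del-is-update T i)

insert : ∀ {n} → Fin n → Subset n → Subset n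
insert i T = T [ i ]≔ true

toggle : ∀ {n} → Fin n → Subset n → Subset n
toggle i T = T [ i ]%= not

del-∌ : ∀ {n} (T : Subset n) i → (T - i) ∌ i
del-∌ T i rewrite del-is-update T i = lookup∘update i T false

del-other : ∀ {n} (T : Subset n) {i j} → i ≢ j → lookup (T - i) j ≡ lookup T j
del-other T {i} {j} i≢j rewrite del-is-update T i = lookup∘update′ (λ e → i≢j (sym e)) T false

insert-∋ : ∀ {n} (T : Subset n) i → insert i T ∋ i
insert-∋ T i = lookup∘update i T true

insert-other : ∀ {n} (T : Subset n) {i j} → i ≢ j → lookup (insert i T) j ≡ lookup T j
insert-other T i≢j = lookup∘update′ (λ e → i≢j (sym e)) T true

toggle-at : ∀ {n} (T : Subset n) i → lookup (toggle i T) i ≡ not (lookup T i)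
toggle-at T i = lookup∘updateAt i T

update-same : ∀ {n} (T : Subset n) i {v} → lookup T i ≡ v → T [ i ]≔ v ≡ T
update-same T i refl = []≔-lookup T i

insert-del : ∀ {n} (T : Subset n) i → T ∋ i → insert i (T - i) ≡ T
insert-del T i T∋i rewrite del-is-update T i = trans ([]≔-idempotent T i) (update-same T i T∋i)

del-insert : ∀ {n} (T : Subset n) i → T ∌ i → insert i T - i ≡ T
del-insert T i T∌i rewrite del-is-update (insert i T) i = trans ([]≔-idempotent T i) (update-same T i T∌i)

del-absent : ∀ {n} (T : Subset n) i → T ∌ i → T - i ≡ T
del-absent T i T∌i = trans (del-is-update T i) (update-same T i T∌i)

del-comm : ∀ {n} (T : Subset n) i j → T - i - j ≡ T - j - i
del-comm T i j with i ≟F j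
... | yes refl = refl
... | no i≢j = begin
  T - i - j                    ≡⟨ cong (_- j) (del-is-update T i) ⟩
  (T [ i ]≔ false) - j         ≡⟨ del-is-update _ j ⟩
  T [ i ]≔ false [ j ]≔ false  ≡⟨ []≔-commutes T i j i≢j ⟩
  T [ j ]≔ false [ i ]≔ false  ≡⟨ sym (del-is-update _ i) ⟩
  (T [ j ]≔ false) - i         ≡⟨ cong (_- i) (sym (del-is-update T j)) ⟩
  T - j - i                    ∎
  where open ≡-Reasoning

insert-del-comm : ∀ {n} (T : Subset n) {i j} → i ≢ j → insert j T - i ≡ insert j (T - i)
insert-del-comm T {i} {j} i≢j = begin
  insert j T - i              ≡⟨ del-is-update (insert j T) i ⟩
  T [ j ]≔ true [ i ]≔ false  ≡⟨ []≔-commutes T j i (λ e → i≢j (sym e)) ⟩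
  T [ i ]≔ false [ j ]≔ true  ≡⟨ cong (insert j) (sym (del-is-update T i)) ⟩
  insert j (T - i)            ∎
  where open ≡-Reasoning

toggle-absent : ∀ {n} (T : Subset n) i → T ∌ i → toggle i T ≡ insert i T
toggle-absent T i T∌i = updateAt-cong-local i T (cong not T∌i)

toggle-present : ∀ {n} (T : Subset n) i → T ∋ i → toggle i T ≡ T - i
toggle-present T i T∋i = trans (updateAt-cong-local i T (cong not T∋i)) (sym (del-is-update T i))

toggle-involutive : ∀ {n} (T : Subset n) i → toggle i (toggle i T) ≡ T
toggle-involutive T i =
  trans (updateAt-updateAt-local i {h = λ b → b} T (not-involutive _)) (updateAt-id-local i T refl)

toggle-≢ : ∀ {n} (T : Subset n) i → T ≢ toggle i T
toggle-≢ T i e = not-≢ (lookup T i) (trans (cong (λ S → lookup S i) e) (toggle-at T i))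
  where
  not-≢ : ∀ b → b ≢ not b
  not-≢ true ()
  not-≢ false ()

∋-del : ∀ {n} (T : Subset n) i {x} → (T - i) ∋ x → i ≢ x × T ∋ x
∋-del T i {x} h with i ≟F x
... | yes refl = ⊥-elim (true≢false (trans (sym h) (del-∌ T i)))
... | no i≢x = i≢x , trans (sym (del-other T i≢x)) h

del-keeps : ∀ {n} (T : Subset n) {i x} → i ≢ x → T ∋ x → (T - i) ∋ x
del-keeps T i≢x T∋x = trans (del-other T i≢x) T∋x

∋-insert : ∀ {n} {T : Subset n} {i x} → insert i T ∋ x → i ≡ x ⊎ T ∋ x
∋-insert {T = T} {i} {x} h with i ≟F x
... | yes i≡x = inj₁ i≡x
... | no i≢x = inj₂ (trans (sym (insert-other T i≢x)) h)

insert-keeps : ∀ {n} (T : Subset n) i {x} → T ∋ x → insert i T ∋ x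
insert-keeps T i {x} T∋x with i ≟F x
... | yes refl = insert-∋ T i
... | no i≢x = trans (insert-other T i≢x) T∋x

del-⊑ : ∀ {n} (C : Subset n) i → C - i ⊑ C
del-⊑ C i x h = proj₂ (∋-del C i h)

del-⊑-trans : ∀ {n} (C T : Subset n) i → C ⊑ T → C - i ⊑ T
del-⊑-trans C T i C⊑T x h = C⊑T x (del-⊑ C i x h)

del-mono : ∀ {n} (C T : Subset n) i → C ⊑ T → C - i ⊑ T - i
del-mono C T i C⊑T x h = let i≢x , C∋x = ∋-del C i h in del-keeps T i≢x (C⊑T x C∋x)

⊑-∌ : ∀ {n} (C T : Subset n) {x} → C ⊑ T → T ∌ x → C ∌ x
⊑-∌ C T {x} C⊑T T∌x with lookup C x in e
... | false = refl
... | true = ⊥-elim (true≢false (trans (sym (C⊑T x e)) T∌x))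

⊑-del : ∀ {n} (C T : Subset n) i → C ∌ i → C ⊑ T → C ⊑ T - i
⊑-del C T i C∌i C⊑T x C∋x = del-keeps T i≢x (C⊑T x C∋x)
  where
  i≢x : i ≢ x
  i≢x refl = true≢false (trans (sym C∋x) C∌i)

⊑-insert : ∀ {n} (C : Subset n) i → C ⊑ insert i C
⊑-insert C i x = insert-keeps C i

insert-⊑ : ∀ {n} (C T : Subset n) i → T ∋ i → C ⊑ T - i → insert i C ⊑ T
insert-⊑ C T i T∋i C⊑T-i x h with ∋-insert {T = C} h
... | inj₁ refl = T∋i
... | inj₂ C∋x = proj₂ (∋-del T i (C⊑T-i x C∋x))

infix 4 _∈ᶠ_ _∉ᶠ_ _⊆ᶠ_

_∈ᶠ_ : ∀ {n} → Subset n → Family n → Set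
T ∈ᶠ 𝓐 = 𝓐 T ≡ true

_∉ᶠ_ : ∀ {n} → Subset n → Family n → Set
T ∉ᶠ 𝓐 = 𝓐 T ≡ false

_⊆ᶠ_ : ∀ {n} → Family n → Family n → Set
𝓐 ⊆ᶠ 𝓐' = ∀ T → T ∈ᶠ 𝓐 → T ∈ᶠ 𝓐'

_∪F_ : ∀ {n} → Family n → Family n → Family n
(𝓐 ∪F 𝓐') T = 𝓐 T ∨ 𝓐' T

∧-elim : ∀ {a b} → a ∧ b ≡ true → a ≡ true × b ≡ true
∧-elim {true} {true} refl = refl , refl

∨-elim : ∀ {a b} → a ∨ b ≡ true → a ≡ true ⊎ b ≡ true
∨-elim {true} h = inj₁ refl
∨-elim {false} h = inj₂ h

∨-introˡ : ∀ {a} b → a ≡ true → a ∨ b ≡ true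
∨-introˡ b refl = refl

∨-introʳ : ∀ a {b} → b ≡ true → a ∨ b ≡ true
∨-introʳ a refl = ∨-zeroʳ a

bool-ext : ∀ {b c} → (b ≡ true → c ≡ true) → (c ≡ true → b ≡ true) → b ≡ c
bool-ext {true} f g = sym (f refl)
bool-ext {false} {true} f g = g refl
bool-ext {false} {false} f g = refl

any-elim : ∀ {A : Set} (p : A → Bool) xs → any p xs ≡ true → Σ A λ x → p x ≡ true
any-elim p (x ∷ xs) h with p x in e
... | true = x , e
... | false = any-elim p xs h

any-intro : ∀ {A : Set} (p : A → Bool) {x} xs → x ∈ xs → p x ≡ true → any p xs ≡ true
any-intro p (y ∷ xs) (here refl) h = ∨-introˡ (any p xs) h
any-intro p (y ∷ xs) (there x∈xs) h = ∨-introʳ (p y) (any-intro p xs x∈xs h)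

all-elim : ∀ {A : Set} (p : A → Bool) xs → all p xs ≡ false → Σ A λ x → p x ≡ false
all-elim p (x ∷ xs) h with p x in e
... | false = x , e
... | true = all-elim p xs h

allSubsets-complete : ∀ {n} (F : Subset n) → F ∈ allSubsets n
allSubsets-complete [] = here refl
allSubsets-complete (false ∷ F) = ∈-++⁺ˡ (∈-map⁺ (false ∷_) (allSubsets-complete F))
allSubsets-complete {suc n} (true ∷ F) =
  ∈-++⁺ʳ (map (false ∷_) (allSubsets n)) (∈-map⁺ (true ∷_) (allSubsets-complete F))

≟S-sound : ∀ {n} {S T : Subset n} → (S ≟S T) ≡ true → S ≡ T
≟S-sound {S = S} {T} h with ≡-dec _≟B_ S T
... | yes S≡T = S≡T

≟S-complete : ∀ {n} {S T : Subset n} → S ≡ T → (S ≟S T) ≡ true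
≟S-complete {S = S} {T} S≡T with ≡-dec _≟B_ S T
... | yes _ = refl
... | no S≢T = ⊥-elim (S≢T S≡T)

χ : Bool → ℕ
χ true = 1
χ false = 0

Σₛ : ∀ {n} → (Subset n → ℕ) → ℕ
Σₛ {zero} h = h []
Σₛ {suc n} h = Σₛ (λ T → h (false ∷ T)) + Σₛ (λ T → h (true ∷ T))

card-split : ∀ {n} (𝓐 : Family (suc n)) →
  card 𝓐 ≡ card (λ T → 𝓐 (false ∷ T)) + card (λ T → 𝓐 (true ∷ T))
card-split {n} 𝓐 = begin
  length (filter P (map (false ∷_) Ts ++ map (true ∷_) Ts))
    ≡⟨ cong length (filter-++ P (map (false ∷_) Ts) (map (true ∷_) Ts)) ⟩
  length (filter P (map (false ∷_) Ts) ++ filter P (map (true ∷_) Ts))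
    ≡⟨ length-++ (filter P (map (false ∷_) Ts)) ⟩
  length (filter P (map (false ∷_) Ts)) + length (filter P (map (true ∷_) Ts))
    ≡⟨ cong₂ _+_ (filter-map false Ts) (filter-map true Ts) ⟩
  card (λ T → 𝓐 (false ∷ T)) + card (λ T → 𝓐 (true ∷ T)) ∎
  where
  open ≡-Reasoning
  Ts = allSubsets n
  P = λ F → 𝓐 F ≟B true
  filter-map : ∀ b xs → length (filter P (map (b ∷_) xs)) ≡ length (filter (λ T → 𝓐 (b ∷ T) ≟B true) xs)
  filter-map b [] = refl
  filter-map b (T ∷ xs) with 𝓐 (b ∷ T)
  ... | true = cong suc (filter-map b xs)
  ... | false = filter-map b xs

card-Σ : ∀ {n} (𝓐 : Family n) → card 𝓐 ≡ Σₛ (λ T → χ (𝓐 T))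
card-Σ {zero} 𝓐 with 𝓐 []
... | true = refl
... | false = refl
card-Σ {suc n} 𝓐 =
  trans (card-split 𝓐) (cong₂ _+_ (card-Σ (λ T → 𝓐 (false ∷ T))) (card-Σ (λ T → 𝓐 (true ∷ T))))

Σ-mono : ∀ {n} {h h' : Subset n → ℕ} → (∀ T → h T ≤ h' T) → Σₛ h ≤ Σₛ h'
Σ-mono {zero} le = le []
Σ-mono {suc n} le = +-mono-≤ (Σ-mono (λ T → le (false ∷ T))) (Σ-mono (λ T → le (true ∷ T)))

Σ-+ : ∀ {n} (h h' : Subset n → ℕ) → Σₛ (λ T → h T + h' T) ≡ Σₛ h + Σₛ h'
Σ-+ {zero} h h' = refl
Σ-+ {suc n} h h' = begin
  Σₛ (λ T → h (false ∷ T) + h' (false ∷ T)) + Σₛ (λ T → h (true ∷ T) + h' (true ∷ T))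
    ≡⟨ cong₂ _+_ (Σ-+ (λ T → h (false ∷ T)) _) (Σ-+ (λ T → h (true ∷ T)) _) ⟩
  (a + a') + (b + b')  ≡⟨ interchange a a' b b' ⟩
  (a + b) + (a' + b')  ∎
  where
  open ≡-Reasoning
  a = Σₛ (λ T → h (false ∷ T))
  a' = Σₛ (λ T → h' (false ∷ T))
  b = Σₛ (λ T → h (true ∷ T))
  b' = Σₛ (λ T → h' (true ∷ T))

-- Toggling a coordinate permutes the subsets, so it does not change a sum.
Σ-toggle : ∀ {n} (i : Fin n) (h : Subset n → ℕ) → Σₛ h ≡ Σₛ (λ T → h (toggle i T))
Σ-toggle {suc n} zero h = +-comm (Σₛ (λ T → h (false ∷ T))) (Σₛ (λ T → h (true ∷ T)))
Σ-toggle {suc n} (suc i) h =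
  cong₂ _+_ (Σ-toggle i (λ T → h (false ∷ T))) (Σ-toggle i (λ T → h (true ∷ T)))

Σ-pairs-≤ : ∀ {n} (i : Fin n) {f g : Subset n → ℕ} →
  (∀ T → f T + f (toggle i T) ≤ g T + g (toggle i T)) → Σₛ f ≤ Σₛ g
Σ-pairs-≤ i {f} {g} pair = half (begin
  Σₛ f + Σₛ f                               ≡⟨ cong (Σₛ f +_) (Σ-toggle i f) ⟩
  Σₛ f + Σₛ (λ T → f (toggle i T))           ≡⟨ sym (Σ-+ f _) ⟩
  Σₛ (λ T → f T + f (toggle i T))            ≤⟨ Σ-mono pair ⟩
  Σₛ (λ T → g T + g (toggle i T))            ≡⟨ Σ-+ g _ ⟩
  Σₛ g + Σₛ (λ T → g (toggle i T))           ≡⟨ cong (Σₛ g +_) (sym (Σ-toggle i g)) ⟩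
  Σₛ g + Σₛ g                               ∎)
  where
  open ≤-Reasoning
  half : ∀ {a b} → a + a ≤ b + b → a ≤ b
  half {a} {b} h with a ≤? b
  ... | yes a≤b = a≤b
  ... | no a≰b = ⊥-elim (<⇒≱ (+-mono-< (≰⇒> a≰b) (≰⇒> a≰b)) h)

Σ-pairs-≡ : ∀ {n} (i : Fin n) {f g : Subset n → ℕ} →
  (∀ T → f T + f (toggle i T) ≡ g T + g (toggle i T)) → Σₛ f ≡ Σₛ g
Σ-pairs-≡ i pair = ≤-antisym (Σ-pairs-≤ i (λ T → ≤-reflexive (pair T)))
                             (Σ-pairs-≤ i (λ T → ≤-reflexive (sym (pair T))))

χ-mono : ∀ {a b} → (a ≡ true → b ≡ true) → χ a ≤ χ b
χ-mono {false} h = z≤n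
χ-mono {true} h rewrite h refl = ≤-refl

card-mono : ∀ {n} {𝓐 𝓐' : Family n} → 𝓐 ⊆ᶠ 𝓐' → card 𝓐 ≤ card 𝓐'
card-mono {𝓐 = 𝓐} {𝓐'} 𝓐⊆𝓐' = begin
  card 𝓐               ≡⟨ card-Σ 𝓐 ⟩
  Σₛ (λ T → χ (𝓐 T))   ≤⟨ Σ-mono (λ T → χ-mono (𝓐⊆𝓐' T)) ⟩
  Σₛ (λ T → χ (𝓐' T))  ≡⟨ sym (card-Σ 𝓐') ⟩
  card 𝓐'              ∎
  where open ≤-Reasoning

card-+-≤ : ∀ {n} {𝓐 𝓑 𝓒 𝓓 : Family n} →
  (∀ T → χ (𝓐 T) + χ (𝓑 T) ≤ χ (𝓒 T) + χ (𝓓 T)) → card 𝓐 + card 𝓑 ≤ card 𝓒 + card 𝓓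
card-+-≤ {𝓐 = 𝓐} {𝓑} {𝓒} {𝓓} pointwise = begin
  card 𝓐 + card 𝓑                          ≡⟨ cong₂ _+_ (card-Σ 𝓐) (card-Σ 𝓑) ⟩
  Σₛ (λ T → χ (𝓐 T)) + Σₛ (λ T → χ (𝓑 T))  ≡⟨ sym (Σ-+ (λ T → χ (𝓐 T)) (λ T → χ (𝓑 T))) ⟩
  Σₛ (λ T → χ (𝓐 T) + χ (𝓑 T))             ≤⟨ Σ-mono pointwise ⟩
  Σₛ (λ T → χ (𝓒 T) + χ (𝓓 T))             ≡⟨ Σ-+ (λ T → χ (𝓒 T)) (λ T → χ (𝓓 T)) ⟩
  Σₛ (λ T → χ (𝓒 T)) + Σₛ (λ T → χ (𝓓 T))  ≡⟨ sym (cong₂ _+_ (card-Σ 𝓒) (card-Σ 𝓓)) ⟩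
  card 𝓒 + card 𝓓                          ∎
  where open ≤-Reasoning

card-∪ : ∀ {n} (𝓐 𝓑 : Family n) → card (𝓐 ∪F 𝓑) ≤ card 𝓐 + card 𝓑
card-∪ 𝓐 𝓑 = begin
  card (𝓐 ∪F 𝓑)                           ≡⟨ card-Σ (𝓐 ∪F 𝓑) ⟩
  Σₛ (λ T → χ (𝓐 T ∨ 𝓑 T))                ≤⟨ Σ-mono (λ T → χ-∨ (𝓐 T) (𝓑 T)) ⟩
  Σₛ (λ T → χ (𝓐 T) + χ (𝓑 T))            ≡⟨ Σ-+ (λ T → χ (𝓐 T)) (λ T → χ (𝓑 T)) ⟩
  Σₛ (λ T → χ (𝓐 T)) + Σₛ (λ T → χ (𝓑 T)) ≡⟨ sym (cong₂ _+_ (card-Σ 𝓐) (card-Σ 𝓑)) ⟩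
  card 𝓐 + card 𝓑                         ∎
  where
  open ≤-Reasoning
  χ-∨ : ∀ a b → χ (a ∨ b) ≤ χ a + χ b
  χ-∨ true b = s≤s z≤n
  χ-∨ false b = ≤-refl

dSet-absent : ∀ {n} i (𝓐 : Family n) {F} → F ∌ i → dSet i 𝓐 F ≡ F
dSet-absent i 𝓐 F∌i rewrite F∌i = refl

dSet-blocked : ∀ {n} i (𝓐 : Family n) {F} → F - i ∈ᶠ 𝓐 → dSet i 𝓐 F ≡ F
dSet-blocked i 𝓐 {F} F-i∈𝓐 rewrite F-i∈𝓐 | ∧-zeroʳ (lookup F i) = refl

dSet-moves : ∀ {n} i (𝓐 : Family n) {F} → F ∋ i → F - i ∉ᶠ 𝓐 → dSet i 𝓐 F ≡ F - i
dSet-moves i 𝓐 F∋i F-i∉𝓐 rewrite F∋i | F-i∉𝓐 = refl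

data StepCase {n} (i : Fin n) (𝓐 : Family n) (F : Subset n) : Set where
  moves   : F ∋ i → F - i ∉ᶠ 𝓐 → dSet i 𝓐 F ≡ F - i → StepCase i 𝓐 F
  absent  : F ∌ i → dSet i 𝓐 F ≡ F → StepCase i 𝓐 F
  blocked : F ∋ i → F - i ∈ᶠ 𝓐 → dSet i 𝓐 F ≡ F → StepCase i 𝓐 F

stepCase : ∀ {n} i (𝓐 : Family n) F → StepCase i 𝓐 F
stepCase i 𝓐 F with lookup F i in F∋i | 𝓐 (F - i) in F-i∈𝓐
... | false | _ = absent F∋i (dSet-absent i 𝓐 F∋i)
... | true | true = blocked F∋i F-i∈𝓐 (dSet-blocked i 𝓐 F-i∈𝓐)
... | true | false = moves F∋i F-i∈𝓐 (dSet-moves i 𝓐 F∋i F-i∈𝓐)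

fixed-or-drops : ∀ {n} i (𝓐 : Family n) F →
  dSet i 𝓐 F ≡ F ⊎ (F ∋ i × F - i ∉ᶠ 𝓐 × dSet i 𝓐 F ≡ F - i)
fixed-or-drops i 𝓐 F with stepCase i 𝓐 F
... | moves F∋i F-i∉𝓐 e = inj₂ (F∋i , F-i∉𝓐 , e)
... | absent _ e = inj₁ e
... | blocked _ _ e = inj₁ e

dSet-local : ∀ {n} i (𝓐 : Family n) F → dSet i 𝓐 F ≡ F ⊎ dSet i 𝓐 F ≡ toggle i F
dSet-local i 𝓐 F with fixed-or-drops i 𝓐 F
... | inj₁ fixed = inj₁ fixed
... | inj₂ (F∋i , _ , e) = inj₂ (trans e (sym (toggle-present F i F∋i)))

∉ᶠ-≢ : ∀ {n} (𝓐 : Family n) {S T} → S ∉ᶠ 𝓐 → T ∈ᶠ 𝓐 → S ≡ T → ⊥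
∉ᶠ-≢ 𝓐 S∉𝓐 T∈𝓐 refl = true≢false (trans (sym T∈𝓐) S∉𝓐)

-- d_(i,𝓐) is injective on 𝓐: a set that dropped lands outside 𝓐, hence differs from every fixed member.
dSet-injective : ∀ {n} i (𝓐 : Family n) {F F'} → F ∈ᶠ 𝓐 → F' ∈ᶠ 𝓐 →
  dSet i 𝓐 F ≡ dSet i 𝓐 F' → F ≡ F'
dSet-injective i 𝓐 {F} {F'} F∈𝓐 F'∈𝓐 d≡d' with fixed-or-drops i 𝓐 F | fixed-or-drops i 𝓐 F'
... | inj₁ e | inj₁ e' = trans (sym e) (trans d≡d' e')
... | inj₁ e | inj₂ (_ , F'-i∉𝓐 , e') = ⊥-elim (∉ᶠ-≢ 𝓐 F'-i∉𝓐 F∈𝓐 (trans (sym e') (trans (sym d≡d') e)))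
... | inj₂ (_ , F-i∉𝓐 , e) | inj₁ e' = ⊥-elim (∉ᶠ-≢ 𝓐 F-i∉𝓐 F'∈𝓐 (trans (sym e) (trans d≡d' e')))
... | inj₂ (F∋i , _ , e) | inj₂ (F'∋i , _ , e') = begin
  F                 ≡⟨ sym (insert-del F i F∋i) ⟩
  insert i (F - i)  ≡⟨ cong (insert i) (trans (sym e) (trans d≡d' e')) ⟩
  insert i (F' - i) ≡⟨ insert-del F' i F'∋i ⟩
  F'                ∎
  where open ≡-Reasoning

dFam-image : ∀ {n} i (𝓐 : Family n) {F} → F ∈ᶠ 𝓐 → dSet i 𝓐 F ∈ᶠ dFam i 𝓐
dFam-image {n} i 𝓐 {F} F∈𝓐 =
  any-intro (λ F' → 𝓐 F' ∧ (dSet i 𝓐 F' ≟S dSet i 𝓐 F)) (allSubsets n) (allSubsets-complete F)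
    (subst (λ b → b ∧ (dSet i 𝓐 F ≟S dSet i 𝓐 F) ≡ true) (sym F∈𝓐) (≟S-complete refl))

dFam-preimage : ∀ {n} i (𝓐 : Family n) {G} → G ∈ᶠ dFam i 𝓐 →
  Σ (Subset n) λ F → F ∈ᶠ 𝓐 × dSet i 𝓐 F ≡ G
dFam-preimage {n} i 𝓐 {G} G∈ with any-elim (λ F → 𝓐 F ∧ (dSet i 𝓐 F ≟S G)) (allSubsets n) G∈
... | F , h = let F∈𝓐 , d≡G = ∧-elim {𝓐 F} h in F , F∈𝓐 , ≟S-sound d≡G

dFam-keep : ∀ {n} i (𝓐 : Family n) {T} → T ∈ᶠ 𝓐 → T - i ∈ᶠ 𝓐 → T ∈ᶠ dFam i 𝓐
dFam-keep i 𝓐 {T} T∈𝓐 T-i∈𝓐 = subst (_∈ᶠ dFam i 𝓐) (dSet-blocked i 𝓐 T-i∈𝓐) (dFam-image i 𝓐 T∈𝓐)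

dFam-keep-absent : ∀ {n} i (𝓐 : Family n) {T} → T ∌ i → T ∈ᶠ 𝓐 → T ∈ᶠ dFam i 𝓐
dFam-keep-absent i 𝓐 T∌i T∈𝓐 = subst (_∈ᶠ dFam i 𝓐) (dSet-absent i 𝓐 T∌i) (dFam-image i 𝓐 T∈𝓐)

dFam-lower : ∀ {n} i (𝓐 : Family n) {T} → T ∌ i → insert i T ∈ᶠ 𝓐 → T ∈ᶠ dFam i 𝓐
dFam-lower i 𝓐 {T} T∌i T+i∈𝓐 with 𝓐 T in T∈𝓐
... | true = dFam-keep-absent i 𝓐 T∌i T∈𝓐
... | false = subst (_∈ᶠ dFam i 𝓐) moved (dFam-image i 𝓐 T+i∈𝓐)
  where
  moved : dSet i 𝓐 (insert i T) ≡ T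
  moved = trans (dSet-moves i 𝓐 (insert-∋ T i) (trans (cong 𝓐 (del-insert T i T∌i)) T∈𝓐))
                (del-insert T i T∌i)

dFam-present : ∀ {n} i (𝓐 : Family n) {T} → T ∋ i → T ∈ᶠ dFam i 𝓐 → T ∈ᶠ 𝓐 × T - i ∈ᶠ 𝓐
dFam-present i 𝓐 {T} T∋i T∈ with dFam-preimage i 𝓐 T∈
... | F , F∈𝓐 , d≡T with stepCase i 𝓐 F
... | moves _ _ e = ⊥-elim (true≢false (trans (sym T∋i) (subst (_∌ i) (trans (sym e) d≡T) (del-∌ F i))))
... | absent F∌i e = ⊥-elim (true≢false (trans (sym T∋i) (subst (_∌ i) (trans (sym e) d≡T) F∌i)))
... | blocked _ F-i∈𝓐 e with trans (sym e) d≡T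
...   | refl = F∈𝓐 , F-i∈𝓐

dFam-absent : ∀ {n} i (𝓐 : Family n) {T} → T ∌ i → T ∈ᶠ dFam i 𝓐 → T ∈ᶠ 𝓐 ⊎ insert i T ∈ᶠ 𝓐
dFam-absent i 𝓐 {T} T∌i T∈ with dFam-preimage i 𝓐 T∈
... | F , F∈𝓐 , d≡T with fixed-or-drops i 𝓐 F
... | inj₁ fixed = inj₁ (subst (_∈ᶠ 𝓐) (trans (sym fixed) d≡T) F∈𝓐)
... | inj₂ (F∋i , _ , e) =
  inj₂ (subst (_∈ᶠ 𝓐) (trans (sym (insert-del F i F∋i)) (cong (insert i) (trans (sym e) d≡T))) F∈𝓐)

dFam-present-≡ : ∀ {n} i (𝓐 : Family n) {T} → T ∋ i → dFam i 𝓐 T ≡ 𝓐 T ∧ 𝓐 (T - i)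
dFam-present-≡ i 𝓐 {T} T∋i = bool-ext
  (λ T∈ → let T∈𝓐 , T-i∈𝓐 = dFam-present i 𝓐 T∋i T∈ in
          subst₂ (λ a b → a ∧ b ≡ true) (sym T∈𝓐) (sym T-i∈𝓐) refl)
  (λ h → let T∈𝓐 , T-i∈𝓐 = ∧-elim {𝓐 T} h in dFam-keep i 𝓐 T∈𝓐 T-i∈𝓐)

dFam-absent-≡ : ∀ {n} i (𝓐 : Family n) {T} → T ∌ i → dFam i 𝓐 T ≡ 𝓐 T ∨ 𝓐 (insert i T)
dFam-absent-≡ i 𝓐 {T} T∌i = bool-ext
  (λ T∈ → [ ∨-introˡ (𝓐 (insert i T)) , ∨-introʳ (𝓐 T) ] (dFam-absent i 𝓐 T∌i T∈))
  (λ h → [ dFam-keep-absent i 𝓐 T∌i , dFam-lower i 𝓐 T∌i ] (∨-elim {𝓐 T} h))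

-- Compression does not change the size of a family: on each pair {T, T + i}
-- it replaces the two memberships a, b by a ∨ b and a ∧ b.
card-dFam : ∀ {n} i (𝓐 : Family n) → card (dFam i 𝓐) ≡ card 𝓐
card-dFam i 𝓐 = begin
  card (dFam i 𝓐)                   ≡⟨ card-Σ (dFam i 𝓐) ⟩
  Σₛ (λ T → χ (dFam i 𝓐 T))          ≡⟨ Σ-pairs-≡ i pair ⟩
  Σₛ (λ T → χ (𝓐 T))                 ≡⟨ sym (card-Σ 𝓐) ⟩
  card 𝓐                            ∎
  where
  open ≡-Reasoning
  ∨∧ : ∀ a b → χ (a ∨ b) + χ (b ∧ a) ≡ χ a + χ b
  ∨∧ true true = refl
  ∨∧ true false = refl
  ∨∧ false true = refl
  ∨∧ false false = refl
  ∧∨ : ∀ a b → χ (a ∧ b) + χ (b ∨ a) ≡ χ a + χ b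
  ∧∨ true true = refl
  ∧∨ true false = refl
  ∧∨ false true = refl
  ∧∨ false false = refl
  pair : ∀ T → χ (dFam i 𝓐 T) + χ (dFam i 𝓐 (toggle i T)) ≡ χ (𝓐 T) + χ (𝓐 (toggle i T))
  pair T with lookup T i in T∋i
  ... | false rewrite toggle-absent T i T∋i | dFam-absent-≡ i 𝓐 {T} T∋i
                    | dFam-present-≡ i 𝓐 {insert i T} (insert-∋ T i) | del-insert T i T∋i =
                    ∨∧ (𝓐 T) (𝓐 (insert i T))
  ... | true rewrite toggle-present T i T∋i | dFam-present-≡ i 𝓐 {T} T∋i
                   | dFam-absent-≡ i 𝓐 {T - i} (del-∌ T i) | insert-del T i T∋i = ∧∨ (𝓐 T) (𝓐 (T - i))

-- The image of 𝓢 under a map φ that changes every set at most in coordinate i: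
-- G is hit iff G itself or toggle i G is sent to G.
imageAt : ∀ {n} → Fin n → (Subset n → Subset n) → Family n → Family n
imageAt i φ 𝓢 G = (𝓢 G ∧ (φ G ≟S G)) ∨ (𝓢 (toggle i G) ∧ (φ (toggle i G) ≟S G))

imageAt-intro : ∀ {n} i (φ : Subset n → Subset n) 𝓢 {F} →
  φ F ≡ F ⊎ φ F ≡ toggle i F → F ∈ᶠ 𝓢 → φ F ∈ᶠ imageAt i φ 𝓢
imageAt-intro i φ 𝓢 {F} (inj₁ fixed) F∈𝓢 =
  subst (_∈ᶠ imageAt i φ 𝓢) (sym fixed)
    (∨-introˡ _ (subst₂ (λ a b → a ∧ b ≡ true) (sym F∈𝓢) (sym (≟S-complete fixed)) refl))
imageAt-intro i φ 𝓢 {F} (inj₂ toggled) F∈𝓢 =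
  subst (_∈ᶠ imageAt i φ 𝓢) (sym toggled) (∨-introʳ _ hit)
  where
  hit : 𝓢 (toggle i (toggle i F)) ∧ (φ (toggle i (toggle i F)) ≟S toggle i F) ≡ true
  hit rewrite toggle-involutive F i | F∈𝓢 = ≟S-complete toggled

-- Such an image is no larger than 𝓢: within a pair {G, toggle i G} no set is
-- sent to both members, so at most as many members are hit as there are preimages.
card-imageAt : ∀ {n} i (φ : Subset n → Subset n) 𝓢 → card (imageAt i φ 𝓢) ≤ card 𝓢
card-imageAt i φ 𝓢 = begin
  card (imageAt i φ 𝓢)                ≡⟨ card-Σ (imageAt i φ 𝓢) ⟩
  Σₛ (λ G → χ (imageAt i φ 𝓢 G))      ≤⟨ Σ-pairs-≤ i pair ⟩
  Σₛ (λ G → χ (𝓢 G))                  ≡⟨ sym (card-Σ 𝓢) ⟩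
  card 𝓢                              ∎
  where
  open ≤-Reasoning
  χ≤1 : ∀ a → χ a ≤ 1
  χ≤1 true = ≤-refl
  χ≤1 false = z≤n
  at-most-one : ∀ a b → (a ≡ true → b ≡ true → ⊥) → χ a + χ b ≤ 1
  at-most-one true true excl = ⊥-elim (excl refl refl)
  at-most-one true false excl = ≤-refl
  at-most-one false b excl = χ≤1 b
  -- s, s' : memberships of G, toggle i G in 𝓢; p, q' : whether G goes to G, toggle i G; q, p' likewise
  pair-bound : ∀ s s' p q p' q' → (p ≡ true → q' ≡ true → ⊥) → (q ≡ true → p' ≡ true → ⊥) →
    χ ((s ∧ p) ∨ (s' ∧ q)) + χ ((s' ∧ p') ∨ (s ∧ q')) ≤ χ s + χ s'
  pair-bound false false p q p' q' _ _ = z≤n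
  pair-bound true true p q p' q' _ _ = +-mono-≤ (χ≤1 (p ∨ q)) (χ≤1 (p' ∨ q'))
  pair-bound true false p q p' q' excl _ rewrite ∨-identityʳ p = at-most-one p q' excl
  pair-bound false true p q p' q' _ excl rewrite ∨-identityʳ p' = at-most-one q p' excl
  one-target : ∀ {S} G → (S ≟S G) ≡ true → (S ≟S toggle i G) ≡ true → ⊥
  one-target G h h' = toggle-≢ G i (trans (sym (≟S-sound h)) (≟S-sound h'))
  pair : ∀ G → χ (imageAt i φ 𝓢 G) + χ (imageAt i φ 𝓢 (toggle i G)) ≤ χ (𝓢 G) + χ (𝓢 (toggle i G))
  pair G rewrite toggle-involutive G i =
    pair-bound (𝓢 G) (𝓢 (toggle i G)) (φ G ≟S G) (φ (toggle i G) ≟S G)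
               (φ (toggle i G) ≟S toggle i G) (φ G ≟S toggle i G)
               (one-target G) (one-target G)

dFam-mono : ∀ {n} i {𝓐 𝓐' : Family n} → 𝓐 ⊆ᶠ 𝓐' → dFam i 𝓐 ⊆ᶠ dFam i 𝓐'
dFam-mono i {𝓐} {𝓐'} 𝓐⊆𝓐' T T∈ with lookup T i in T∋i
... | true = let T∈𝓐 , T-i∈𝓐 = dFam-present i 𝓐 T∋i T∈ in
  dFam-keep i 𝓐' (𝓐⊆𝓐' T T∈𝓐) (𝓐⊆𝓐' (T - i) T-i∈𝓐)
... | false = [ (λ T∈𝓐 → dFam-keep-absent i 𝓐' T∋i (𝓐⊆𝓐' T T∈𝓐))
              , (λ T+i∈𝓐 → dFam-lower i 𝓐' T∋i (𝓐⊆𝓐' _ T+i∈𝓐)) ] (dFam-absent i 𝓐 T∋i T∈)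

ClosedUnder : ∀ {n} → Fin n → Family n → Set
ClosedUnder i 𝓐 = ∀ T → T ∈ᶠ 𝓐 → T - i ∈ᶠ 𝓐

dFam-closed : ∀ {n} i (𝓐 : Family n) → ClosedUnder i (dFam i 𝓐)
dFam-closed i 𝓐 T T∈ with lookup T i in T∋i
... | true = dFam-keep-absent i 𝓐 (del-∌ T i) (proj₂ (dFam-present i 𝓐 T∋i T∈))
... | false = subst (_∈ᶠ dFam i 𝓐) (sym (del-absent T i T∋i)) T∈

dFam-keeps-closed : ∀ {n} i j (𝓐 : Family n) → ClosedUnder i 𝓐 → ClosedUnder i (dFam j 𝓐)
dFam-keeps-closed i j 𝓐 closed with i ≟F j
... | yes refl = dFam-closed i 𝓐
... | no i≢j = keep
  where
  keep : ClosedUnder i (dFam j 𝓐)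
  keep T T∈ with lookup T j in T∋j
  ... | true = let T∈𝓐 , T-j∈𝓐 = dFam-present j 𝓐 T∋j T∈ in
    dFam-keep j 𝓐 (closed T T∈𝓐) (subst (_∈ᶠ 𝓐) (del-comm T j i) (closed (T - j) T-j∈𝓐))
  ... | false = [ (λ T∈𝓐 → dFam-keep-absent j 𝓐 (del-false T∋j) (closed T T∈𝓐))
                , (λ T+j∈𝓐 → dFam-lower j 𝓐 (del-false T∋j)
                     (subst (_∈ᶠ 𝓐) (insert-del-comm T i≢j) (closed (insert j T) T+j∈𝓐))) ]
                (dFam-absent j 𝓐 T∋j T∈)
    where
    del-false : T ∌ j → T - i ∌ j
    del-false T∌j = trans (del-other T i≢j) T∌j

Interval : ∀ {n} → Fin n → Subset n → Family n → Set
Interval r F 𝓐 = ∀ C → C ∋ r → C ⊑ F → C ∈ᶠ 𝓐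

Below : ∀ {n} → Subset n → Family n → Set
Below T 𝓐 = ∀ C → C ⊑ T → C ∈ᶠ 𝓐

dFam-keeps-Interval : ∀ {n} i {r} F (𝓐 : Family n) → i ≢ r → Interval r F 𝓐 → Interval r F (dFam i 𝓐)
dFam-keeps-Interval i F 𝓐 i≢r int C C∋r C⊑F =
  dFam-keep i 𝓐 (int C C∋r C⊑F) (int (C - i) (del-keeps C i≢r C∋r) (del-⊑-trans C F i C⊑F))

dFam-keeps-Below : ∀ {n} i T (𝓐 : Family n) → Below T 𝓐 → Below T (dFam i 𝓐)
dFam-keeps-Below i T 𝓐 below C C⊑T = dFam-keep i 𝓐 (below C C⊑T) (below (C - i) (del-⊑-trans C T i C⊑T))

dFam-root-Below : ∀ {n} r F (𝓐 : Family n) → F ∋ r → Interval r F 𝓐 → Below (F - r) (dFam r 𝓐)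
dFam-root-Below r F 𝓐 F∋r int C C⊑F-r =
  dFam-lower r 𝓐 C∌r (int (insert r C) (insert-∋ C r) (insert-⊑ C F r F∋r C⊑F-r))
  where
  C∌r : C ∌ r
  C∌r = ⊑-∌ C (F - r) C⊑F-r (del-∌ F r)

dFam-root-Below-top : ∀ {n} r F (𝓐 : Family n) → Interval r F 𝓐 → Below (F - r) 𝓐 → Below F (dFam r 𝓐)
dFam-root-Below-top r F 𝓐 int below C C⊑F with lookup C r in C∋r
... | true = dFam-keep r 𝓐 (int C C∋r C⊑F) (below (C - r) (del-mono C F r C⊑F))
... | false = dFam-keep-absent r 𝓐 C∋r (below C (⊑-del C F r C∋r C⊑F))

Rooted : ∀ {n} → Family n → Set
Rooted {n} 𝓐 = ∀ T → T ∈ᶠ 𝓐 → ∀ x → T ∋ x → Σ (Fin n) λ b → T ∋ b × Interval b T 𝓐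

rooted : ∀ {n} {𝓐 : Family n} → SimplyRooted 𝓐 → Rooted 𝓐
rooted sr T T∈𝓐 x T∋x with sr T T∈𝓐 (x , lookup⇒[]= x T T∋x)
... | b , b∈T , int = b , []=⇒lookup b∈T ,
      λ C C∋b C⊑T → int C (lookup⇒[]= b C C∋b) (λ {y} y∈C → lookup⇒[]= y T (C⊑T y ([]=⇒lookup y∈C)))

point? : ∀ {n} (T : Subset n) → (Σ (Fin n) λ x → T ∋ x) ⊎ (∀ x → T ∌ x)
point? [] = inj₂ (λ ())
point? (true ∷ T) = inj₁ (zero , refl)
point? (false ∷ T) with point? T
... | inj₁ (x , T∋x) = inj₁ (suc x , T∋x)
... | inj₂ none = inj₂ λ { zero → refl ; (suc x) → none x }

-- A set that newly enters the family by compression enters with all its subsets: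
-- it is T = F - k for a member F whose root must be k.
dFam-new-Below : ∀ {n} k (𝓐 : Family n) {T} → Rooted 𝓐 → T ∉ᶠ 𝓐 → T ∈ᶠ dFam k 𝓐 → Below T (dFam k 𝓐)
dFam-new-Below k 𝓐 {T} root T∉𝓐 T∈ with lookup T k in T∋k
... | true = ⊥-elim (∉ᶠ-≢ 𝓐 T∉𝓐 (proj₁ (dFam-present k 𝓐 T∋k T∈)) refl)
... | false with dFam-absent k 𝓐 T∋k T∈
...   | inj₁ T∈𝓐 = ⊥-elim (∉ᶠ-≢ 𝓐 T∉𝓐 T∈𝓐 refl)
...   | inj₂ T+k∈𝓐 with root (insert k T) T+k∈𝓐 k (insert-∋ T k)
...     | b , T+k∋b , int with k ≟F b
...       | yes refl = subst (λ S → Below S (dFam k 𝓐)) (del-insert T k T∋k)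
                         (dFam-root-Below k (insert k T) 𝓐 (insert-∋ T k) int)
...       | no k≢b = ⊥-elim (∉ᶠ-≢ 𝓐 T∉𝓐 (int T T∋b (⊑-insert T k)) refl)
  where
  T∋b : T ∋ b
  T∋b = trans (sym (insert-other T k≢b)) T+k∋b

-- If k is the root of T ∈ 𝓐 and T - k ∈ 𝓐, then T keeps a root after compressing in direction k:
-- the root of T - k if T - k is nonempty, and k itself otherwise.
dFam-root-of-fixed : ∀ {n} k (𝓐 : Family n) {T} → Rooted 𝓐 → T ∋ k → T - k ∈ᶠ 𝓐 →
  Interval k T 𝓐 → Σ (Fin n) λ b → T ∋ b × Interval b T (dFam k 𝓐)
dFam-root-of-fixed k 𝓐 {T} root T∋k T-k∈𝓐 int with point? (T - k)
... | inj₂ none = k , T∋k , λ C C∋k C⊑T →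
  dFam-keep k 𝓐 (int C C∋k C⊑T) (subst (_∈ᶠ 𝓐) (sym (same-rest C C⊑T)) T-k∈𝓐)
  where
  same-rest : ∀ C → C ⊑ T → C - k ≡ T - k
  same-rest C C⊑T = subset-ext λ x → trans (⊑-∌ (C - k) (T - k) (del-mono C T k C⊑T) (none x)) (sym (none x))
... | inj₁ (y , T-k∋y) with root (T - k) T-k∈𝓐 y T-k∋y
...   | b , T-k∋b , int' = b , proj₂ (∋-del T k T-k∋b) , interval
  where
  interval : Interval b T (dFam k 𝓐)
  interval C C∋b C⊑T with lookup C k in C∋k
  ... | true = dFam-keep k 𝓐 (int C C∋k C⊑T)
                 (int' (C - k) (del-keeps C (proj₁ (∋-del T k T-k∋b)) C∋b) (del-mono C T k C⊑T))
  ... | false = dFam-keep-absent k 𝓐 C∋k (int' C C∋b (⊑-del C T k C∋k C⊑T))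

dFam-Rooted : ∀ {n} k (𝓐 : Family n) → Rooted 𝓐 → Rooted (dFam k 𝓐)
dFam-Rooted k 𝓐 root T T∈ x T∋x with lookup T k in T∋k
... | true = present (dFam-present k 𝓐 T∋k T∈)
  where
  present : T ∈ᶠ 𝓐 × T - k ∈ᶠ 𝓐 → Σ _ λ b → T ∋ b × Interval b T (dFam k 𝓐)
  present (T∈𝓐 , T-k∈𝓐) with root T T∈𝓐 x T∋x
  ... | b , T∋b , int with k ≟F b
  ...   | yes refl = dFam-root-of-fixed k 𝓐 root T∋k T-k∈𝓐 int
  ...   | no k≢b = b , T∋b , dFam-keeps-Interval k T 𝓐 k≢b int
... | false with 𝓐 T in T∈𝓐
...   | false = x , T∋x , λ C _ C⊑T → dFam-new-Below k 𝓐 root T∈𝓐 T∈ C C⊑T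
...   | true with root T T∈𝓐 x T∋x
...     | b , T∋b , int = b , T∋b , dFam-keeps-Interval k T 𝓐 k≢b int
  where
  k≢b : k ≢ b
  k≢b refl = true≢false (trans (sym T∋b) T∋k)

dFams : ∀ {n} → List (Fin n) → Family n → Family n
dFams [] 𝓐 = 𝓐
dFams (i ∷ l) 𝓐 = dFams l (dFam i 𝓐)

dSets : ∀ {n} → List (Fin n) → Family n → Subset n → Subset n
dSets [] 𝓐 F = F
dSets (i ∷ l) 𝓐 F = dSets l (dFam i 𝓐) (dSet i 𝓐 F)

dTot-dSets : ∀ {n} (𝓐 : Family n) F → dTot 𝓐 F ≡ dSets (allFin n) 𝓐 F
dTot-dSets {n} 𝓐 F = cong proj₂ (fold (allFin n) 𝓐 F)
  where
  fold : ∀ l 𝓐 F → foldl step (𝓐 , F) l ≡ (dFams l 𝓐 , dSets l 𝓐 F)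
  fold [] 𝓐 F = refl
  fold (i ∷ l) 𝓐 F = fold l (dFam i 𝓐) (dSet i 𝓐 F)

dSets-++ : ∀ {n} (l l' : List (Fin n)) 𝓐 F → dSets (l ++ l') 𝓐 F ≡ dSets l' (dFams l 𝓐) (dSets l 𝓐 F)
dSets-++ [] l' 𝓐 F = refl
dSets-++ (i ∷ l) l' 𝓐 F = dSets-++ l l' (dFam i 𝓐) (dSet i 𝓐 F)

card-dFams : ∀ {n} (l : List (Fin n)) 𝓐 → card (dFams l 𝓐) ≡ card 𝓐
card-dFams [] 𝓐 = refl
card-dFams (i ∷ l) 𝓐 = trans (card-dFams l (dFam i 𝓐)) (card-dFam i 𝓐)

dFams-preimage : ∀ {n} (l : List (Fin n)) 𝓐 {G} → G ∈ᶠ dFams l 𝓐 →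
  Σ (Subset n) λ F → F ∈ᶠ 𝓐 × dSets l 𝓐 F ≡ G
dFams-preimage [] 𝓐 {G} G∈𝓐 = G , G∈𝓐 , refl
dFams-preimage (i ∷ l) 𝓐 G∈ with dFams-preimage l (dFam i 𝓐) G∈
... | F' , F'∈ , path with dFam-preimage i 𝓐 F'∈
...   | F , F∈𝓐 , refl = F , F∈𝓐 , path

dSets-injective : ∀ {n} (l : List (Fin n)) 𝓐 {F F'} → F ∈ᶠ 𝓐 → F' ∈ᶠ 𝓐 → dSets l 𝓐 F ≡ dSets l 𝓐 F' → F ≡ F'
dSets-injective [] 𝓐 _ _ e = e
dSets-injective (i ∷ l) 𝓐 F∈𝓐 F'∈𝓐 e = dSet-injective i 𝓐 F∈𝓐 F'∈𝓐
  (dSets-injective l (dFam i 𝓐) (dFam-image i 𝓐 F∈𝓐) (dFam-image i 𝓐 F'∈𝓐) e)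

dFams-mono : ∀ {n} (l : List (Fin n)) {𝓐 𝓐' : Family n} → 𝓐 ⊆ᶠ 𝓐' → dFams l 𝓐 ⊆ᶠ dFams l 𝓐'
dFams-mono [] 𝓐⊆𝓐' = 𝓐⊆𝓐'
dFams-mono (i ∷ l) 𝓐⊆𝓐' = dFams-mono l (dFam-mono i 𝓐⊆𝓐')

dFams-closed : ∀ {n} i (l : List (Fin n)) 𝓐 → i ∈ l → ClosedUnder i (dFams l 𝓐)
dFams-closed i (i ∷ l) 𝓐 (here refl) = keep l (dFam i 𝓐) (dFam-closed i 𝓐)
  where
  keep : ∀ l 𝓐 → ClosedUnder i 𝓐 → ClosedUnder i (dFams l 𝓐)
  keep [] 𝓐 closed = closed
  keep (j ∷ l) 𝓐 closed = keep l (dFam j 𝓐) (dFam-keeps-closed i j 𝓐 closed)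
dFams-closed i (j ∷ l) 𝓐 (there i∈l) = dFams-closed i l (dFam j 𝓐) i∈l

dFams-keeps-Interval : ∀ {n} (l : List (Fin n)) {r} F 𝓐 → All (_≢ r) l → F ∋ r → Interval r F 𝓐 →
  Interval r F (dFams l 𝓐) × dSets l 𝓐 F ≡ F
dFams-keeps-Interval [] F 𝓐 [] F∋r int = int , refl
dFams-keeps-Interval (i ∷ l) F 𝓐 (i≢r ∷ l≢r) F∋r int
  rewrite dSet-blocked i 𝓐 (int (F - i) (del-keeps F i≢r F∋r) (del-⊑ F i)) =
  dFams-keeps-Interval l F (dFam i 𝓐) l≢r F∋r (dFam-keeps-Interval i F 𝓐 i≢r int)

dFams-keeps-Below : ∀ {n} (l : List (Fin n)) T 𝓐 → Below T 𝓐 → Below T (dFams l 𝓐) × dSets l 𝓐 T ≡ T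
dFams-keeps-Below [] T 𝓐 below = below , refl
dFams-keeps-Below (i ∷ l) T 𝓐 below rewrite dSet-blocked i 𝓐 (below (T - i) (del-⊑ T i)) =
  dFams-keeps-Below l T (dFam i 𝓐) (dFam-keeps-Below i T 𝓐 below)

dFams-new-Below : ∀ {n} (l : List (Fin n)) 𝓐 {T} → Rooted 𝓐 → T ∉ᶠ 𝓐 → T ∈ᶠ dFams l 𝓐 → Below T (dFams l 𝓐)
dFams-new-Below [] 𝓐 root T∉𝓐 T∈𝓐 = ⊥-elim (∉ᶠ-≢ 𝓐 T∉𝓐 T∈𝓐 refl)
dFams-new-Below (i ∷ l) 𝓐 {T} root T∉𝓐 T∈ with dFam i 𝓐 T in T∈dFam
... | true = proj₁ (dFams-keeps-Below l T (dFam i 𝓐) (dFam-new-Below i 𝓐 root T∉𝓐 T∈dFam))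
... | false = dFams-new-Below l (dFam i 𝓐) (dFam-Rooted i 𝓐 root) T∈dFam T∈

-- The image of 𝓢 under F ↦ dSets l 𝓐 F, built one direction at a time; it is no larger than 𝓢.
dImage : ∀ {n} → List (Fin n) → Family n → Family n → Family n
dImage [] 𝓐 𝓢 = 𝓢
dImage (i ∷ l) 𝓐 𝓢 = dImage l (dFam i 𝓐) (imageAt i (dSet i 𝓐) 𝓢)

dImage-intro : ∀ {n} (l : List (Fin n)) 𝓐 𝓢 {F} → F ∈ᶠ 𝓢 → dSets l 𝓐 F ∈ᶠ dImage l 𝓐 𝓢
dImage-intro [] 𝓐 𝓢 F∈𝓢 = F∈𝓢
dImage-intro (i ∷ l) 𝓐 𝓢 {F} F∈𝓢 =
  dImage-intro l (dFam i 𝓐) (imageAt i (dSet i 𝓐) 𝓢) (imageAt-intro i (dSet i 𝓐) 𝓢 (dSet-local i 𝓐 F) F∈𝓢)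

card-dImage : ∀ {n} (l : List (Fin n)) 𝓐 𝓢 → card (dImage l 𝓐 𝓢) ≤ card 𝓢
card-dImage [] 𝓐 𝓢 = ≤-refl
card-dImage (i ∷ l) 𝓐 𝓢 = ≤-trans (card-dImage l (dFam i 𝓐) _) (card-imageAt i (dSet i 𝓐) 𝓢)

allFin-split : ∀ {n} (r : Fin n) → Σ (List (Fin n)) λ pre → Σ (List (Fin n)) λ post →
  allFin n ≡ pre ++ r ∷ post × All (_≢ r) pre
allFin-split {suc n} zero = [] , tabulate suc , refl , []
allFin-split {suc n} (suc r) with allFin-split r
... | pre , post , split , pre≢r =
  zero ∷ map suc pre , map suc post , cong (zero ∷_) shifted , (λ ()) ∷ shift pre≢r
  where
  shifted : tabulate {n = n} suc ≡ map suc pre ++ suc r ∷ map suc post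
  shifted = trans (sym (map-tabulate (λ x → x) suc))
                  (trans (cong (map suc) split) (map-++ suc pre (r ∷ post)))
  shift : ∀ {l} → All (_≢ r) l → All (_≢ suc r) (map suc l)
  shift [] = []
  shift (i≢r ∷ l≢r) = (λ e → i≢r (suc-injective e)) ∷ shift l≢r

dSets-until-root : ∀ {n} pre post {r} F (𝓐 : Family n) → All (_≢ r) pre → F ∋ r → Interval r F 𝓐 →
  Interval r F (dFams pre 𝓐)
  × dSets (pre ++ r ∷ post) 𝓐 F ≡ dSets post (dFam r (dFams pre 𝓐)) (dSet r (dFams pre 𝓐) F)
dSets-until-root pre post {r} F 𝓐 pre≢r F∋r int =
  proj₁ kept ,
  trans (dSets-++ pre (r ∷ post) 𝓐 F) (cong (λ S → dSets post (dFam r 𝓟) (dSet r 𝓟 S)) (proj₂ kept))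
  where
  𝓟 = dFams pre 𝓐
  kept = dFams-keeps-Interval pre F 𝓐 pre≢r F∋r int

-- At step r the set F stays if F - r has entered the family by then
-- (which for F - r ∉ 𝓐 makes F the top of a down-set), and drops to F - r otherwise; either way it is
-- then the top of a down-set that no later compression disturbs.
dSets-root-stays : ∀ {n} pre post r F (𝓐 : Family n) → Rooted 𝓐 → All (_≢ r) pre → F ∋ r →
  Interval r F 𝓐 → F - r ∉ᶠ 𝓐 → F - r ∈ᶠ dFams pre 𝓐 → dSets (pre ++ r ∷ post) 𝓐 F ≡ F
dSets-root-stays pre post r F 𝓐 root pre≢r F∋r int F-r∉𝓐 F-r∈𝓟 = begin
  dSets (pre ++ r ∷ post) 𝓐 F         ≡⟨ proj₂ until ⟩
  dSets post (dFam r 𝓟) (dSet r 𝓟 F)  ≡⟨ cong (dSets post (dFam r 𝓟)) (dSet-blocked r 𝓟 F-r∈𝓟) ⟩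
  dSets post (dFam r 𝓟) F             ≡⟨ proj₂ (dFams-keeps-Below post F (dFam r 𝓟) below) ⟩
  F                                   ∎
  where
  open ≡-Reasoning
  𝓟 = dFams pre 𝓐
  until = dSets-until-root pre post F 𝓐 pre≢r F∋r int
  below : Below F (dFam r 𝓟)
  below = dFam-root-Below-top r F 𝓟 (proj₁ until) (dFams-new-Below pre 𝓐 root F-r∉𝓐 F-r∈𝓟)

dSets-root-drops : ∀ {n} pre post r F (𝓐 : Family n) → All (_≢ r) pre → F ∋ r →
  Interval r F 𝓐 → F - r ∉ᶠ dFams pre 𝓐 → dSets (pre ++ r ∷ post) 𝓐 F ≡ F - r
dSets-root-drops pre post r F 𝓐 pre≢r F∋r int F-r∉𝓟 = begin
  dSets (pre ++ r ∷ post) 𝓐 F         ≡⟨ proj₂ until ⟩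
  dSets post (dFam r 𝓟) (dSet r 𝓟 F)  ≡⟨ cong (dSets post (dFam r 𝓟)) (dSet-moves r 𝓟 F∋r F-r∉𝓟) ⟩
  dSets post (dFam r 𝓟) (F - r)       ≡⟨ proj₂ (dFams-keeps-Below post (F - r) (dFam r 𝓟) below) ⟩
  F - r                               ∎
  where
  open ≡-Reasoning
  𝓟 = dFams pre 𝓐
  until = dSets-until-root pre post F 𝓐 pre≢r F∋r int
  below : Below (F - r) (dFam r 𝓟)
  below = dFam-root-Below r F 𝓟 F∋r (proj₁ until)

δ-witness : ∀ {n} (𝓐 : Family n) F → δ⊆ F 𝓐 ≡ false → Σ (Fin n) λ j → F ∋ j × F - j ∉ᶠ 𝓐
δ-witness {n} 𝓐 F δ⊄ with all-elim (λ i → not (lookup F i) ∨ 𝓐 (F - i)) (allFin n) δ⊄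
... | j , h with lookup F j in F∋j | 𝓐 (F - j) in F-j∉𝓐
...   | true | false = j , F∋j , F-j∉𝓐

-- If F - j ∉ 𝓐 for some j ∈ F, then also F - r ∉ 𝓐 for the root r ∈ F of any interval [{r}, F] ⊆ 𝓐:
-- otherwise r = j, or F - j would lie in the interval.
root-drops-out : ∀ {n} (𝓐 : Family n) {F r j} → F ∋ j → F - j ∉ᶠ 𝓐 → F ∋ r → Interval r F 𝓐 → F - r ∉ᶠ 𝓐
root-drops-out 𝓐 {F} {r} {j} F∋j F-j∉𝓐 F∋r int with r ≟F j
... | yes refl = F-j∉𝓐
... | no r≢j = ⊥-elim (∉ᶠ-≢ 𝓐 F-j∉𝓐 (int (F - j) (del-keeps F (λ e → r≢j (sym e)) F∋r) (del-⊑ F j)) refl)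

⊆ᶠ-∉ : ∀ {n} {𝓐 𝓐' : Family n} {T} → 𝓐 ⊆ᶠ 𝓐' → T ∉ᶠ 𝓐' → T ∉ᶠ 𝓐
⊆ᶠ-∉ {𝓐 = 𝓐} {𝓐'} {T} 𝓐⊆𝓐' T∉𝓐' with 𝓐 T in T∈𝓐
... | false = refl
... | true = ⊥-elim (∉ᶠ-≢ 𝓐' T∉𝓐' (𝓐⊆𝓐' T T∈𝓐) refl)

not-bad : ∀ {n} (𝓑 : Family n) {F} → F ∈ᶠ 𝓑 → isBad 𝓑 F ≡ false →
  δ⊆ F 𝓑 ≡ false × dSets (allFin n) 𝓑 F ≢ F
not-bad 𝓑 {F} F∈𝓑 good rewrite F∈𝓑 with δ⊆ F 𝓑 | dTot 𝓑 F ≟S F in unfixed | dTot-dSets 𝓑 F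
... | false | false | dTot≡ =
  refl , λ fixed → true≢false (trans (sym (≟S-complete (trans dTot≡ fixed))) unfixed)

-- For the root r of F in 𝓑' we have F - r ∉ 𝓑, so d_𝓑 sends F to F - r
-- (staying at F is excluded), and so does d_𝓑', because its families stay inside those of 𝓑.
dSets-agree : ∀ {n} (𝓑 𝓑' : Family n) {F} → Rooted 𝓑 → Rooted 𝓑' → 𝓑' ⊆ᶠ 𝓑 → F ∈ᶠ 𝓑' →
  isBad 𝓑 F ≡ false → dSets (allFin n) 𝓑' F ≡ dSets (allFin n) 𝓑 F
dSets-agree {n} 𝓑 𝓑' {F} root root' 𝓑'⊆𝓑 F∈𝓑' good with not-bad 𝓑 (𝓑'⊆𝓑 F F∈𝓑') good
... | δ⊄ , unfixed with δ-witness 𝓑 F δ⊄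
... | j , F∋j , F-j∉𝓑 with root' F F∈𝓑' j F∋j
... | r , F∋r , int' with allFin-split r
... | pre , post , split , pre≢r = begin
  dSets (allFin n) 𝓑' F        ≡⟨ cong (λ l → dSets l 𝓑' F) split ⟩
  dSets (pre ++ r ∷ post) 𝓑' F ≡⟨ dSets-root-drops pre post r F 𝓑' pre≢r F∋r int' F-r∉𝓟' ⟩
  F - r                        ≡⟨ sym (dSets-root-drops pre post r F 𝓑 pre≢r F∋r int F-r∉𝓟) ⟩
  dSets (pre ++ r ∷ post) 𝓑 F  ≡⟨ cong (λ l → dSets l 𝓑 F) (sym split) ⟩
  dSets (allFin n) 𝓑 F         ∎
  where
  open ≡-Reasoning
  int : Interval r F 𝓑
  int C C∋r C⊑F = 𝓑'⊆𝓑 C (int' C C∋r C⊑F)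
  F-r∉𝓑 : F - r ∉ᶠ 𝓑
  F-r∉𝓑 = root-drops-out 𝓑 F∋j F-j∉𝓑 F∋r int
  F-r∉𝓟 : F - r ∉ᶠ dFams pre 𝓑
  F-r∉𝓟 with dFams pre 𝓑 (F - r) in F-r∈𝓟
  ... | false = refl
  ... | true = ⊥-elim (unfixed (trans (cong (λ l → dSets l 𝓑 F) split)
                 (dSets-root-stays pre post r F 𝓑 root pre≢r F∋r int F-r∉𝓑 F-r∈𝓟)))
  F-r∉𝓟' : F - r ∉ᶠ dFams pre 𝓑'
  F-r∉𝓟' = ⊆ᶠ-∉ (dFams-mono pre 𝓑'⊆𝓑) F-r∉𝓟

Down : ∀ {n} → Family n → Set
Down {n} 𝓓 = (i : Fin n) → ClosedUnder i 𝓓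

dFams-Down : ∀ {n} (𝓐 : Family n) → Down (dFams (allFin n) 𝓐)
dFams-Down {n} 𝓐 i = dFams-closed i (allFin n) 𝓐 (∈-allFin i)

chebyshev₂ : ∀ a₀ a₁ c₀ c₁ → a₁ ≤ a₀ → c₁ ≤ c₀ → (a₀ + a₁) * (c₀ + c₁) ≤ 2 * (a₀ * c₀ + a₁ * c₁)
chebyshev₂ a₀ a₁ c₀ c₁ a₁≤a₀ c₁≤c₀ with m≤n⇒∃[o]m+o≡n a₁≤a₀ | m≤n⇒∃[o]m+o≡n c₁≤c₀
... | p , refl | q , refl = subst ((a₁ + p + a₁) * (c₁ + q + c₁) ≤_) (sym (identity a₁ p c₁ q)) (m≤m+n _ _)
  where
  identity : ∀ a p c q → 2 * ((a + p) * (c + q) + a * c) ≡ (a + p + a) * (c + q + c) + p * q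
  identity = solve-∀

-- Induction on n, splitting each family by whether the set contains the first point; for a down-set
-- the half containing it is the smaller one, which is where Chebyshev's inequality applies.
kleitman : ∀ n (𝓓 𝓔 : Family n) → Down 𝓓 → Down 𝓔 → card 𝓓 * card 𝓔 ≤ 2 ^ n * card (𝓓 ∩F 𝓔)
kleitman zero 𝓓 𝓔 _ _ with 𝓓 [] | 𝓔 []
... | true | true = ≤-refl
... | true | false = z≤n
... | false | _ = z≤n
kleitman (suc n) 𝓓 𝓔 down-𝓓 down-𝓔 = begin
  card 𝓓 * card 𝓔                     ≡⟨ cong₂ _*_ (card-split 𝓓) (card-split 𝓔) ⟩
  (a₀ + a₁) * (c₀ + c₁)               ≤⟨ chebyshev₂ a₀ a₁ c₀ c₁ (upper≤lower 𝓓 down-𝓓) (upper≤lower 𝓔 down-𝓔) ⟩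
  2 * (a₀ * c₀ + a₁ * c₁)             ≤⟨ *-monoʳ-≤ 2 (+-mono-≤ lower-halves upper-halves) ⟩
  2 * (2 ^ n * k₀ + 2 ^ n * k₁)       ≡⟨ cong (2 *_) (sym (*-distribˡ-+ (2 ^ n) k₀ k₁)) ⟩
  2 * (2 ^ n * (k₀ + k₁))             ≡⟨ sym (*-assoc 2 (2 ^ n) (k₀ + k₁)) ⟩
  2 ^ suc n * (k₀ + k₁)               ≡⟨ cong (2 ^ suc n *_) (sym (card-split (𝓓 ∩F 𝓔))) ⟩
  2 ^ suc n * card (𝓓 ∩F 𝓔)           ∎
  where
  open ≤-Reasoning
  lower upper : Family (suc n) → Family n
  lower 𝓐 T = 𝓐 (false ∷ T)
  upper 𝓐 T = 𝓐 (true ∷ T)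
  𝓓₀ = lower 𝓓
  𝓓₁ = upper 𝓓
  𝓔₀ = lower 𝓔
  𝓔₁ = upper 𝓔
  a₀ = card 𝓓₀
  a₁ = card 𝓓₁
  c₀ = card 𝓔₀
  c₁ = card 𝓔₁
  k₀ = card (𝓓₀ ∩F 𝓔₀)
  k₁ = card (𝓓₁ ∩F 𝓔₁)
  -- removing the first point maps the upper half of a down-set into its lower half
  upper≤lower : ∀ 𝓐 → Down 𝓐 → card (upper 𝓐) ≤ card (lower 𝓐)
  upper≤lower 𝓐 down = card-mono λ T T∈ →
    subst (λ S → 𝓐 (false ∷ S) ≡ true) (p─⊥≡p T) (down zero (true ∷ T) T∈)
  lower-halves : a₀ * c₀ ≤ 2 ^ n * k₀
  lower-halves = kleitman n 𝓓₀ 𝓔₀ (λ i T → down-𝓓 (suc i) (false ∷ T)) (λ i T → down-𝓔 (suc i) (false ∷ T))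
  upper-halves : a₁ * c₁ ≤ 2 ^ n * k₁
  upper-halves = kleitman n 𝓓₁ 𝓔₁ (λ i T → down-𝓓 (suc i) (true ∷ T)) (λ i T → down-𝓔 (suc i) (true ∷ T))

module CompressedIntersection {n} (𝓑 𝓑₁ 𝓑₂ : Family n) (root : Rooted 𝓑) (root₁ : Rooted 𝓑₁)
  (root₂ : Rooted 𝓑₂) (𝓑₁⊆𝓑 : 𝓑₁ ⊆ᶠ 𝓑) (𝓑₂⊆𝓑 : 𝓑₂ ⊆ᶠ 𝓑) where

  L : List (Fin n)
  L = allFin n

  -- Preimages of the intersection: bad members of 𝓑₂, and members of 𝓑₁ that are bad or in 𝓑₂.
  𝓢₁ 𝓢₂ : Family n
  𝓢₁ = 𝓑₁ ∩F (isBad 𝓑 ∪F 𝓑₂)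
  𝓢₂ = 𝓑₂ ∩F isBad 𝓑

  -- Every G ∈ 𝓓₁ ∩ 𝓓₂ is d_𝓑₁(F₁) = d_𝓑₂(F₂) with Fⱼ ∈ 𝓑ⱼ. If F₂ is bad, G is an image of 𝓢₂;
  -- otherwise F₁ ∈ 𝓢₁: if F₁ is not bad either, the key lemma gives d_𝓑(F₁) = G = d_𝓑(F₂), and
  -- injectivity of d_𝓑 gives F₁ = F₂ ∈ 𝓑₂.
  covered : (dFams L 𝓑₁ ∩F dFams L 𝓑₂) ⊆ᶠ (dImage L 𝓑₁ 𝓢₁ ∪F dImage L 𝓑₂ 𝓢₂)
  covered G G∈ with ∧-elim {dFams L 𝓑₁ G} G∈
  ... | G∈𝓓₁ , G∈𝓓₂ with dFams-preimage L 𝓑₁ G∈𝓓₁ | dFams-preimage L 𝓑₂ G∈𝓓₂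
  ... | F₁ , F₁∈𝓑₁ , refl | F₂ , F₂∈𝓑₂ , paths-meet with isBad 𝓑 F₂ in F₂-bad
  ... | true = ∨-introʳ _ (subst (_∈ᶠ dImage L 𝓑₂ 𝓢₂) paths-meet (dImage-intro L 𝓑₂ 𝓢₂ F₂∈𝓢₂))
    where
    F₂∈𝓢₂ : F₂ ∈ᶠ 𝓢₂
    F₂∈𝓢₂ rewrite F₂∈𝓑₂ = F₂-bad
  ... | false = ∨-introˡ _ (dImage-intro L 𝓑₁ 𝓢₁ F₁∈𝓢₁)
    where
    same : isBad 𝓑 F₁ ≡ false → F₁ ≡ F₂
    same F₁-good = dSets-injective L 𝓑 (𝓑₁⊆𝓑 F₁ F₁∈𝓑₁) (𝓑₂⊆𝓑 F₂ F₂∈𝓑₂) (begin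
      dSets L 𝓑 F₁   ≡⟨ sym (dSets-agree 𝓑 𝓑₁ root root₁ 𝓑₁⊆𝓑 F₁∈𝓑₁ F₁-good) ⟩
      dSets L 𝓑₁ F₁  ≡⟨ sym paths-meet ⟩
      dSets L 𝓑₂ F₂  ≡⟨ dSets-agree 𝓑 𝓑₂ root root₂ 𝓑₂⊆𝓑 F₂∈𝓑₂ F₂-bad ⟩
      dSets L 𝓑 F₂   ∎)
      where open ≡-Reasoning
    F₁∈𝓢₁ : F₁ ∈ᶠ 𝓢₁
    F₁∈𝓢₁ rewrite F₁∈𝓑₁ with isBad 𝓑 F₁ in F₁-bad
    ... | true = refl
    ... | false = subst (_∈ᶠ 𝓑₂) (sym (same F₁-bad)) F₂∈𝓑₂

  bound : card (dFams L 𝓑₁ ∩F dFams L 𝓑₂) ≤ numBad 𝓑 + card (𝓑₁ ∩F 𝓑₂)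
  bound = begin
    card (dFams L 𝓑₁ ∩F dFams L 𝓑₂)                ≤⟨ card-mono covered ⟩
    card (dImage L 𝓑₁ 𝓢₁ ∪F dImage L 𝓑₂ 𝓢₂)         ≤⟨ card-∪ (dImage L 𝓑₁ 𝓢₁) (dImage L 𝓑₂ 𝓢₂) ⟩
    card (dImage L 𝓑₁ 𝓢₁) + card (dImage L 𝓑₂ 𝓢₂)  ≤⟨ +-mono-≤ (card-dImage L 𝓑₁ 𝓢₁) (card-dImage L 𝓑₂ 𝓢₂) ⟩
    card 𝓢₁ + card 𝓢₂                             ≤⟨ card-+-≤ (λ T → pointwise (𝓑₁ T) (𝓑₂ T) (isBad 𝓑 T)) ⟩
    numBad 𝓑 + card (𝓑₁ ∩F 𝓑₂)                    ∎
    where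
    open ≤-Reasoning
    pointwise : ∀ b₁ b₂ bad → χ (b₁ ∧ (bad ∨ b₂)) + χ (b₂ ∧ bad) ≤ χ bad + χ (b₁ ∧ b₂)
    pointwise true true true = ≤-refl
    pointwise true true false = ≤-refl
    pointwise true false true = ≤-refl
    pointwise true false false = ≤-refl
    pointwise false true true = ≤-refl
    pointwise false true false = ≤-refl
    pointwise false false true = z≤n
    pointwise false false false = ≤-refl

corollary18 : (n : ℕ) (𝓑 𝓑₁ 𝓑₂ : Family n) →
    SimplyRooted 𝓑 → SimplyRooted 𝓑₁ → SimplyRooted 𝓑₂ →
    ((F : Subset n) → 𝓑 F ≡ 𝓑₁ F ∨ 𝓑₂ F) →
    card 𝓑₁ * card 𝓑₂ ≤ 2 ^ n * (numBad 𝓑 + card (𝓑₁ ∩F 𝓑₂))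
corollary18 n 𝓑 𝓑₁ 𝓑₂ sr sr₁ sr₂ 𝓑≡𝓑₁∪𝓑₂ = begin
  card 𝓑₁ * card 𝓑₂                        ≡⟨ sym (cong₂ _*_ (card-dFams L 𝓑₁) (card-dFams L 𝓑₂)) ⟩
  card 𝓓₁ * card 𝓓₂                        ≤⟨ kleitman n 𝓓₁ 𝓓₂ (dFams-Down 𝓑₁) (dFams-Down 𝓑₂) ⟩
  2 ^ n * card (𝓓₁ ∩F 𝓓₂)                  ≤⟨ *-monoʳ-≤ (2 ^ n) intersection-bound ⟩
  2 ^ n * (numBad 𝓑 + card (𝓑₁ ∩F 𝓑₂))     ∎
  where
  open ≤-Reasoning
  L = allFin n
  𝓓₁ = dFams L 𝓑₁
  𝓓₂ = dFams L 𝓑₂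
  𝓑₁⊆𝓑 : 𝓑₁ ⊆ᶠ 𝓑
  𝓑₁⊆𝓑 F F∈𝓑₁ = trans (𝓑≡𝓑₁∪𝓑₂ F) (∨-introˡ (𝓑₂ F) F∈𝓑₁)
  𝓑₂⊆𝓑 : 𝓑₂ ⊆ᶠ 𝓑
  𝓑₂⊆𝓑 F F∈𝓑₂ = trans (𝓑≡𝓑₁∪𝓑₂ F) (∨-introʳ (𝓑₁ F) F∈𝓑₂)
  intersection-bound : card (𝓓₁ ∩F 𝓓₂) ≤ numBad 𝓑 + card (𝓑₁ ∩F 𝓑₂)
  intersection-bound = CompressedIntersection.bound 𝓑 𝓑₁ 𝓑₂ (rooted sr) (rooted sr₁) (rooted sr₂) 𝓑₁⊆𝓑 𝓑₂⊆𝓑
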